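{- Every cubic $3$-arc-transitive graph of girth $6$ has a consistent $6$-cycle.
   Context: A $3$-arc is a sequence of vertices $x_0x_1x_2x_3$ with $x_ix_{i+1}$ edges and $x_i\neq x_{i+2}$; a graph is $3$-arc-transitive if its automorphism group acts transitively on its $3$-arcs. A cycle $v_0v_1\cdots v_{k-1}v_0$ is consistent if some automorphism $\gamma$ satisfies $\gamma(v_i)=v_{i+1}$ for all $i$ (indices mod $k$). The girth is the length of a shortest cycle. -}

module Defs where

open import Data.Nat using (ℕ; zero; suc; _≤_; _<_; _%_)
open import Data.Nat.DivMod using (m%n<n)
open import Data.Fin using (Fin; toℕ; fromℕ<)
open import Data.Fin.Properties using ()
open import Data.Bool using (Bool; true; false)
open import Data.List using (List; length)
open import Data.List.Base using (filterᵇ)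
open import Data.List using () renaming (allFin to allFinL)
open import Data.Product using (Σ; ∃; _×_; _,_)
open import Function.Bundles using (_↔_; Inverse)
open import Relation.Binary.PropositionalEquality using (_≡_)
open import Relation.Nullary using (¬_)
open import Function.Definitions using (Injective)

record SimpleGraph (n : ℕ) : Set where
  field
    adj     : Fin n → Fin n → Bool
    symm    : ∀ x y → adj x y ≡ adj y x
    loopless : ∀ x → adj x x ≡ false

open SimpleGraph public

module _ {n : ℕ} (G : SimpleGraph n) where

  Edge : Fin n → Fin n → Set
  Edge x y = adj G x y ≡ true

  neighbours : Fin n → List (Fin n)
  neighbours x = filterᵇ (adj G x) (allFinL n)

  Cubic : Set
  Cubic = ∀ x → length (neighbours x) ≡ 3

  record Automorphism : Set where
    field
      perm     : Fin n ↔ Fin n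
      preserve : ∀ x y → adj G (Inverse.to perm x) (Inverse.to perm y) ≡ adj G x y

  open Automorphism public

  apply : Automorphism → Fin n → Fin n
  apply γ = Inverse.to (perm γ)

  record ThreeArc : Set where
    constructor arc
    field
      x0 x1 x2 x3 : Fin n
      e01 : Edge x0 x1
      e12 : Edge x1 x2
      e23 : Edge x2 x3
      n02 : ¬ (x0 ≡ x2)
      n13 : ¬ (x1 ≡ x3)

  open ThreeArc public

  ThreeArcTransitive : Set
  ThreeArcTransitive =
    ∀ (a b : ThreeArc) → Σ Automorphism λ γ →
      (apply γ (x0 a) ≡ x0 b) × (apply γ (x1 a) ≡ x1 b) ×
      (apply γ (x2 a) ≡ x2 b) × (apply γ (x3 a) ≡ x3 b)

sucMod : ∀ {m} → Fin (suc m) → Fin (suc m)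
sucMod {m} i = fromℕ< (m%n<n (suc (toℕ i)) (suc m))

module _ {n : ℕ} (G : SimpleGraph n) where

  -- a cycle of length k = suc m (k ≥ 3): k distinct vertices v_0 … v_{k-1}
  -- with v_i adjacent to v_{i+1 mod k}
  record IsCycle (m : ℕ) (v : Fin (suc m) → Fin n) : Set where
    field
      length≥3 : 3 ≤ suc m
      distinct : Injective _≡_ _≡_ v
      edges    : ∀ i → Edge G (v i) (v (sucMod i))

  Consistent : (m : ℕ) → (Fin (suc m) → Fin n) → Set
  Consistent m v = Σ (Automorphism G) λ γ → ∀ i → apply G γ (v i) ≡ v (sucMod i)

  HasGirth : ℕ → Set
  HasGirth (suc m) =
    (∃ λ (v : Fin (suc m) → Fin n) → IsCycle m v) ×
    (∀ k → suc k < suc m → (v : Fin (suc k) → Fin n) → ¬ IsCycle k v)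
  HasGirth zero = Data.Empty.⊥
    where import Data.Empty

{-# OPTIONS --safe #-}
-- Say that two 4-arcs are similar when an automorphism maps one onto the other. By 3-arc-transitivity
-- every 4-arc is similar to one of the two extensions of any fixed 3-arc, so there are at most two
-- similarity classes. If the 4-arcs w₀…w₄ and w₁…w₅ of a hexagon w₀…w₅ are similar, the hexagon is
-- consistent: the automorphism sends w₅ to a common neighbour of w₅ and w₁, which by girth 6 is w₀.
-- Call two 4-arcs apart when their similarity would yield a consistent hexagon. Consecutive 4-arcs
-- of a hexagon are apart, and so are the two extensions of a 3-arc (if these were similar there
-- would be a single class). With at most two classes, a closed walk of odd length through apart
-- pairs therefore yields a consistent hexagon.
--
-- Such a walk is built around a hexagon h₀…h₅, which exists as the girth is 6. Every 4-arc lies on a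
-- hexagon: both extensions of h₁h₂h₃h₄ do (one on h₀…h₅, the other on the image of h₀…h₅ under an
-- automorphism mapping h₀h₁h₂h₃ to h₁h₂h₃h₄, unless that image shows h₀…h₅ consistent).
-- Let p and q be the third neighbours of h₃ and h₂, and close h₀h₁h₂h₃p, qh₂h₃h₄h₅, c₂qh₂h₃p and
-- h₁h₂h₃pc₃ to hexagons with new corners c₁, c₂, c₃, c₄. The walk of length 13 is
--   h₀h₁h₂h₃h₄, h₁h₂h₃h₄h₅, h₂h₃h₄h₅h₀, h₂h₃h₄h₅c₂, qh₂h₃h₄h₅, c₂qh₂h₃h₄, c₂qh₂h₃p,
--   qh₂h₃pc₃, h₂h₃pc₃c₂, h₂h₃pc₃c₄, h₁h₂h₃pc₃, h₁h₂h₃pc₁, h₀h₁h₂h₃p, h₀h₁h₂h₃h₄.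
module Submission where

open import Data.Bool.Properties using (T-≡)
open import Data.Fin using (Fin; zero; suc; #_; _≟_)
open import Data.Fin.Properties using (injective⇒≤)
open import Data.List using (List; []; _∷_; length; allFin)
import Data.List as List
open import Data.List.Membership.Propositional using (_∈_; find; lose)
open import Data.List.Membership.Propositional.Properties using (∈-filter⁺; ∈-filter⁻; ∈-allFin; ∈-lookup)
open import Data.List.Membership.Setoid.Properties using (index-injective)
open import Data.List.Relation.Binary.Subset.Propositional using (_⊆_)
open import Data.List.Relation.Unary.All using ([]; _∷_)
import Data.List.Relation.Unary.All as All
open import Data.List.Relation.Unary.AllPairs using ([]; _∷_)
open import Data.List.Relation.Unary.Any using (here; there; any?; index)
open import Data.List.Relation.Unary.Unique.Propositional using (Unique)
open import Data.List.Relation.Unary.Unique.Propositional.Properties using (filter⁺; allFin⁺)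
open import Data.Nat using (ℕ; suc; _≤_; _<_; s≤s; z≤n)
open import Data.Nat.Properties using (1+n≰n)
open import Data.Product using (Σ; ∃; _×_; _,_; proj₁; proj₂)
open import Data.Sum using (_⊎_; inj₁; inj₂; [_,_]′) renaming (map to ⊎-map)
open import Data.Vec using (Vec; []; _∷_; _∷ʳ_; map; lookup)
open import Data.Vec.Relation.Unary.All using ([]; _∷_)
open import Data.Vec.Relation.Unary.AllPairs using ([]; _∷_)
open import Data.Vec.Properties using (map-∘; map-cong; map-id; map-∷ʳ; lookup-map)
import Data.Vec.Relation.Unary.Unique.Propositional as Uniqueᵛ
open import Data.Vec.Relation.Unary.Unique.Propositional.Properties using (lookup-injective)
open import Defs
open import Function using (id; _∘_)
open import Function.Bundles using (Inverse; Injection; Equivalence)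
open import Function.Construct.Composition using (_↔-∘_)
open import Function.Construct.Identity using (↔-id)
open import Function.Construct.Symmetry using (↔-sym)
open import Function.Properties.Inverse using (↔⇒↣)
open import Level using (_⊔_)
open import Relation.Binary.Bundles using (Setoid)
import Relation.Binary.Construct.On as On
open import Relation.Binary.PropositionalEquality
open import Relation.Nullary using (¬_; yes; no; ¬?; contradiction)
open import Relation.Nullary.Decidable using (_×-dec_; T?)

module _ {a} {A : Set a} where

  Unique⇒lookup-injective : {xs : List A} → Unique xs → ∀ {i j} → List.lookup xs i ≡ List.lookup xs j → i ≡ j
  Unique⇒lookup-injective (_  ∷ _) {zero}  {zero}  _  = refl
  Unique⇒lookup-injective (x∉ ∷ _) {zero}  {suc j} eq = contradiction eq (All.lookup x∉ (∈-lookup j))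
  Unique⇒lookup-injective (x∉ ∷ _) {suc i} {zero}  eq = contradiction (sym eq) (All.lookup x∉ (∈-lookup i))
  Unique⇒lookup-injective (_  ∷ u) {suc i} {suc j} eq = cong suc (Unique⇒lookup-injective u eq)

  unique-⊆⇒length≤ : {xs ys : List A} → Unique xs → xs ⊆ ys → length xs ≤ length ys
  unique-⊆⇒length≤ u xs⊆ys = injective⇒≤ {f = λ i → index (xs⊆ys (∈-lookup i))} λ {i} {j} eq →
    Unique⇒lookup-injective u (index-injective (setoid A) (xs⊆ys (∈-lookup i)) (xs⊆ys (∈-lookup j)) eq)

module TwoClassWalks {c ℓ} (S : Setoid c ℓ) where

  open Setoid S using (_≈_) renaming (Carrier to X; refl to ≈-refl; sym to ≈-sym; trans to ≈-trans)

  private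
    variable
      p q x y z : X

  TwoClasses : X → X → Set (c ⊔ ℓ)
  TwoClasses p q = ∀ x → x ≈ p ⊎ x ≈ q

  collapse : TwoClasses p q → p ≈ q → ∀ x y → x ≈ y
  collapse two p≈q x y with two x | two y
  ... | inj₁ x≈p | inj₁ y≈p = ≈-trans x≈p (≈-sym y≈p)
  ... | inj₁ x≈p | inj₂ y≈q = ≈-trans x≈p (≈-trans p≈q (≈-sym y≈q))
  ... | inj₂ x≈q | inj₁ y≈p = ≈-trans x≈q (≈-sym (≈-trans y≈p p≈q))
  ... | inj₂ x≈q | inj₂ y≈q = ≈-trans x≈q (≈-sym y≈q)

  module Walks {r} (R : Set r) where

    Apart : X → X → Set (ℓ ⊔ r)
    Apart x y = x ≈ y → R

    apart-sym : Apart x y → Apart y x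
    apart-sym x#y y≈x = x#y (≈-sym y≈x)

    infix  3 _∎
    infixr 2 _─⟨_⟩_

    data EvenWalk : X → X → Set (c ⊔ ℓ ⊔ r)
    data OddWalk  : X → X → Set (c ⊔ ℓ ⊔ r)

    data EvenWalk where
      _∎     : (x : X) → EvenWalk x x
      _─⟨_⟩_ : (x : X) → Apart x y → OddWalk y z → EvenWalk x z

    data OddWalk where
      _─⟨_⟩_ : (x : X) → Apart x y → EvenWalk y z → OddWalk x z

    module _ (two : TwoClasses p q) where

      apart-apart : Apart x y → Apart y z → R ⊎ x ≈ z
      apart-apart {x} {y} {z} x#y y#z with two x | two y | two z
      ... | inj₁ x≈p | inj₁ y≈p | _        = inj₁ (x#y (≈-trans x≈p (≈-sym y≈p)))
      ... | inj₂ x≈q | inj₂ y≈q | _        = inj₁ (x#y (≈-trans x≈q (≈-sym y≈q)))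
      ... | _        | inj₁ y≈p | inj₁ z≈p = inj₁ (y#z (≈-trans y≈p (≈-sym z≈p)))
      ... | _        | inj₂ y≈q | inj₂ z≈q = inj₁ (y#z (≈-trans y≈q (≈-sym z≈q)))
      ... | inj₁ x≈p | inj₂ _   | inj₁ z≈p = inj₂ (≈-trans x≈p (≈-sym z≈p))
      ... | inj₂ x≈q | inj₁ _   | inj₂ z≈q = inj₂ (≈-trans x≈q (≈-sym z≈q))

      even-walk : EvenWalk x y → R ⊎ x ≈ y
      odd-walk  : OddWalk x y → Apart x y

      even-walk (x ∎)            = inj₂ ≈-refl
      even-walk (x ─⟨ x#y ⟩ odd) = apart-apart x#y (odd-walk odd)

      odd-walk (x ─⟨ x#y ⟩ even) x≈z =
        [ id , (λ y≈z → x#y (≈-trans x≈z (≈-sym y≈z))) ]′ (even-walk even)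

module _ {n : ℕ} {G : SimpleGraph n} where

  private
    variable
      k m : ℕ
      a b c d t u v u′ v′ x y : Fin n

  Edge-sym : Edge G x y → Edge G y x
  Edge-sym {x} {y} xy = trans (symm G y x) xy

  Edge⇒≢ : Edge G x y → x ≢ y
  Edge⇒≢ {x} xx refl with trans (sym xx) (loopless G x)
  ... | ()

  Edge⇒∈neighbours : Edge G x y → y ∈ neighbours G x
  Edge⇒∈neighbours {x} {y} xy = ∈-filter⁺ (T? ∘ adj G x) (∈-allFin y) (Equivalence.from T-≡ xy)

  ∈neighbours⇒Edge : y ∈ neighbours G x → Edge G x y
  ∈neighbours⇒Edge {y} {x} y∈ =
    Equivalence.to T-≡ (proj₂ (∈-filter⁻ (T? ∘ adj G x) {xs = allFin n} y∈))

  neighbours-unique : ∀ x → Unique (neighbours G x)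
  neighbours-unique x = filter⁺ (T? ∘ adj G x) {xs = allFin n} (allFin⁺ n)

  module _ (cubic : Cubic G) where

    neighbour-among-three : Edge G x a → Edge G x b → Edge G x c → a ≢ b → a ≢ c → b ≢ c →
                            Edge G x t → t ≡ a ⊎ t ≡ b ⊎ t ≡ c
    neighbour-among-three {x} {a} {b} {c} {t} xa xb xc a≢b a≢c b≢c xt
      with t ≟ a | t ≟ b | t ≟ c
    ... | yes t≡a | _       | _       = inj₁ t≡a
    ... | no _    | yes t≡b | _       = inj₂ (inj₁ t≡b)
    ... | no _    | no _    | yes t≡c = inj₂ (inj₂ t≡c)
    ... | no t≢a  | no t≢b  | no t≢c  =
      contradiction (subst (4 ≤_) (cubic x) (unique-⊆⇒length≤ four-distinct four⊆)) 1+n≰n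
      where
        four-distinct : Unique (a ∷ b ∷ c ∷ t ∷ [])
        four-distinct = (a≢b ∷ a≢c ∷ ≢-sym t≢a ∷ []) ∷ (b≢c ∷ ≢-sym t≢b ∷ []) ∷ (≢-sym t≢c ∷ []) ∷ [] ∷ []
        four⊆ : a ∷ b ∷ c ∷ t ∷ [] ⊆ neighbours G x
        four⊆ = All.lookup (Edge⇒∈neighbours xa ∷ Edge⇒∈neighbours xb
                          ∷ Edge⇒∈neighbours xc ∷ Edge⇒∈neighbours xt ∷ [])

    third-neighbour : Edge G x a → Edge G x b → a ≢ b → ∃ λ c → Edge G x c × c ≢ a × c ≢ b
    third-neighbour {x} {a} {b} xa xb a≢b with any? (λ c → ¬? (c ≟ a) ×-dec ¬? (c ≟ b)) (neighbours G x)
    ... | yes found = let c , c∈ , c≢a,b = find found in c , ∈neighbours⇒Edge c∈ , c≢a,b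
    ... | no none   =
      contradiction (subst (_≤ 2) (cubic x) (unique-⊆⇒length≤ (neighbours-unique x) ⊆ab)) 1+n≰n
      where
        ⊆ab : neighbours G x ⊆ a ∷ b ∷ []
        ⊆ab {c} c∈ with c ≟ a | c ≟ b
        ... | yes c≡a | _       = here c≡a
        ... | no _    | yes c≡b = there (here c≡b)
        ... | no c≢a  | no c≢b  = contradiction (lose c∈ (c≢a , c≢b)) none

  apply-injective : (γ : Automorphism G) → apply G γ x ≡ apply G γ y → x ≡ y
  apply-injective γ = Injection.injective (↔⇒↣ (perm γ))

  Edge-apply : (γ : Automorphism G) → Edge G x y → Edge G (apply G γ x) (apply G γ y)
  Edge-apply {x} {y} γ xy = trans (preserve γ x y) xy

  idᴬ : Automorphism G
  idᴬ = record { perm = ↔-id _ ; preserve = λ _ _ → refl }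

  _∘ᴬ_ : Automorphism G → Automorphism G → Automorphism G
  γ ∘ᴬ δ = record
    { perm     = perm γ ↔-∘ perm δ
    ; preserve = λ x y → trans (preserve γ _ _) (preserve δ x y)
    }

  _⁻¹ᴬ : Automorphism G → Automorphism G
  γ ⁻¹ᴬ = record
    { perm     = ↔-sym (perm γ)
    ; preserve = λ x y → trans (sym (preserve γ _ _)) (cong₂ (adj G) (to∘from x) (to∘from y))
    }
    where to∘from = Inverse.strictlyInverseˡ (perm γ)

  infix 4 _≅_

  _≅_ : Vec (Fin n) k → Vec (Fin n) k → Set
  xs ≅ ys = Σ (Automorphism G) λ γ → map (apply G γ) xs ≡ ys

  ≅-refl : {xs : Vec (Fin n) k} → xs ≅ xs
  ≅-refl {xs = xs} = idᴬ , map-id xs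

  ≅-sym : {xs ys : Vec (Fin n) k} → xs ≅ ys → ys ≅ xs
  ≅-sym {xs = xs} (γ , refl) = γ ⁻¹ᴬ , (begin
    map (apply G (γ ⁻¹ᴬ)) (map (apply G γ) xs) ≡⟨ map-∘ (apply G (γ ⁻¹ᴬ)) (apply G γ) xs ⟨
    map (apply G (γ ⁻¹ᴬ) ∘ apply G γ) xs        ≡⟨ map-cong (Inverse.strictlyInverseʳ (perm γ)) xs ⟩
    map id xs                                    ≡⟨ map-id xs ⟩
    xs                                           ∎)
    where open ≡-Reasoning

  ≅-trans : {xs ys zs : Vec (Fin n) k} → xs ≅ ys → ys ≅ zs → xs ≅ zs
  ≅-trans {xs = xs} (γ , refl) (δ , refl) = δ ∘ᴬ γ , map-∘ (apply G δ) (apply G γ) xs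

  ≅-setoid : ℕ → Setoid _ _
  ≅-setoid k = record
    { Carrier       = Vec (Fin n) k
    ; _≈_           = _≅_
    ; isEquivalence = record { refl = ≅-refl ; sym = ≅-sym ; trans = ≅-trans }
    }

  apply-lookup : {xs ys : Vec (Fin n) k} (γ : Automorphism G) → map (apply G γ) xs ≡ ys →
                 ∀ i → apply G γ (lookup xs i) ≡ lookup ys i
  apply-lookup {xs = xs} γ refl i = sym (lookup-map i (apply G γ) xs)

  ≅-∷ʳ : {xs ys : Vec (Fin n) k} (γ : Automorphism G) → map (apply G γ) xs ≡ ys → apply G γ x ≡ y →
         xs ∷ʳ x ≅ ys ∷ʳ y
  ≅-∷ʳ {x = x} {xs = xs} γ refl refl = γ , map-∷ʳ (apply G γ) x xs

  TriangleFree : Set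
  TriangleFree = ∀ {a b c} → Edge G a b → Edge G b c → ¬ Edge G c a

  QuadrangleFree : Set
  QuadrangleFree = ∀ {a b c d} → Edge G a b → Edge G b c → Edge G c d → a ≢ c → b ≢ d → ¬ Edge G d a

  girth>3⇒triangle-free : HasGirth G (suc m) → 3 < suc m → TriangleFree
  girth>3⇒triangle-free (_ , no-shorter-cycle) 3<g {a} {b} {c} ab bc ca =
    no-shorter-cycle 2 3<g (lookup (a ∷ b ∷ c ∷ [])) record
      { length≥3 = s≤s (s≤s (s≤s z≤n))
      ; distinct = λ {i} {j} → lookup-injective distinct i j
      ; edges    = λ { zero → ab ; (suc zero) → bc ; (suc (suc zero)) → ca }
      }
    where
      distinct : Uniqueᵛ.Unique (a ∷ b ∷ c ∷ [])
      distinct = (Edge⇒≢ ab ∷ ≢-sym (Edge⇒≢ ca) ∷ []) ∷ (Edge⇒≢ bc ∷ []) ∷ [] ∷ []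

  girth>4⇒quadrangle-free : HasGirth G (suc m) → 4 < suc m → QuadrangleFree
  girth>4⇒quadrangle-free (_ , no-shorter-cycle) 4<g {a} {b} {c} {d} ab bc cd a≢c b≢d da =
    no-shorter-cycle 3 4<g (lookup (a ∷ b ∷ c ∷ d ∷ [])) record
      { length≥3 = s≤s (s≤s (s≤s z≤n))
      ; distinct = λ {i} {j} → lookup-injective distinct i j
      ; edges    = λ { zero → ab ; (suc zero) → bc ; (suc (suc zero)) → cd ; (suc (suc (suc zero))) → da }
      }
    where
      distinct : Uniqueᵛ.Unique (a ∷ b ∷ c ∷ d ∷ [])
      distinct = (Edge⇒≢ ab ∷ a≢c ∷ ≢-sym (Edge⇒≢ da) ∷ [])
               ∷ (Edge⇒≢ bc ∷ b≢d ∷ [])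
               ∷ (Edge⇒≢ cd ∷ [])
               ∷ [] ∷ []

  three-arc-head-distinct : TriangleFree → (s : ThreeArc G) → x0 s ≢ x1 s × x0 s ≢ x2 s × x0 s ≢ x3 s
  three-arc-head-distinct triangle-free s@(arc _ _ _ _ ab bc cd a≢c _) = Edge⇒≢ ab , a≢c , a≢d
    where
      a≢d : x0 s ≢ x3 s
      a≢d refl = triangle-free ab bc cd

  module _ (quadrangle-free : QuadrangleFree) where

    three-arc-ends-nonadjacent : (s : ThreeArc G) → ¬ Edge G (x3 s) (x0 s)
    three-arc-ends-nonadjacent (arc _ _ _ _ ab bc cd a≢c b≢d) = quadrangle-free ab bc cd a≢c b≢d

    common-neighbour-unique : a ≢ c → Edge G a b → Edge G b c → Edge G a d → Edge G d c → b ≡ d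
    common-neighbour-unique {b = b} {d = d} a≢c ab bc ad dc with b ≟ d
    ... | yes b≡d = b≡d
    ... | no b≢d  = contradiction (Edge-sym ad) (quadrangle-free ab bc (Edge-sym dc) a≢c b≢d)

  record Extension (u v : Fin n) : Set where
    constructor extension
    field
      tip       : Fin n
      step      : Edge G v tip
      no-return : u ≢ tip

  open Extension public

  infixl 5 _⁺_

  record FourArc : Set where
    constructor _⁺_
    field
      stem : ThreeArc G
      ext  : Extension (x2 stem) (x3 stem)

  open FourArc public

  vertices₃ : ThreeArc G → Vec (Fin n) 4
  vertices₃ s = x0 s ∷ x1 s ∷ x2 s ∷ x3 s ∷ []

  vertices₄ : FourArc → Vec (Fin n) 5
  vertices₄ (s ⁺ e) = vertices₃ s ∷ʳ tip e

  FourArc-setoid : Setoid _ _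
  FourArc-setoid = On.setoid (≅-setoid 5) vertices₄

  map-extension : (γ : Automorphism G) → apply G γ u ≡ u′ → apply G γ v ≡ v′ → Extension u v → Extension u′ v′
  map-extension γ γu≡u′ γv≡v′ (extension t vt u≢t) = extension (apply G γ t)
    (subst (λ w → Edge G w (apply G γ t)) γv≡v′ (Edge-apply γ vt))
    (λ u′≡γt → u≢t (apply-injective γ (trans γu≡u′ u′≡γt)))

  record Fork (u v : Fin n) : Set where
    constructor fork
    field
      left right  : Extension u v
      tips-differ : tip left ≢ tip right

  open Fork public

  module _ (cubic : Cubic G) where

    extension-left-or-right : Edge G u v → (F : Fork u v) (e : Extension u v) →
                              tip e ≡ tip (left F) ⊎ tip e ≡ tip (right F)
    extension-left-or-right uv (fork (extension _ vl u≢l) (extension _ vr u≢r) l≢r) (extension _ vt u≢t)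
      with neighbour-among-three cubic (Edge-sym uv) vl vr u≢l u≢r l≢r vt
    ... | inj₁ t≡u     = contradiction (sym t≡u) u≢t
    ... | inj₂ t≡l⊎t≡r = t≡l⊎t≡r

    fork-from : Edge G u v → Extension u v → Fork u v
    fork-from uv e@(extension t vt u≢t) =
      let w , vw , w≢u , w≢t = third-neighbour cubic (Edge-sym uv) vt u≢t
      in  fork e (extension w vw (≢-sym w≢u)) (≢-sym w≢t)

    module _ (3at : ThreeArcTransitive G) where

      three-arcs-≅ : (s t : ThreeArc G) → vertices₃ s ≅ vertices₃ t
      three-arcs-≅ s t =
        let γ , γx0 , γx1 , γx2 , γx3 = 3at s t
        in  γ , cong₂ _∷_ γx0 (cong₂ _∷_ γx1 (cong₂ _∷_ γx2 (cong (_∷ []) γx3)))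

      ≅-left-or-right : (a : FourArc) (s : ThreeArc G) (F : Fork (x2 s) (x3 s)) →
                        vertices₄ a ≅ vertices₄ (s ⁺ left F) ⊎ vertices₄ a ≅ vertices₄ (s ⁺ right F)
      ≅-left-or-right (t ⁺ e) s F =
        let γ , γt≡s = three-arcs-≅ t s
            γe       = map-extension γ (apply-lookup γ γt≡s (# 2)) (apply-lookup γ γt≡s (# 3)) e
        in  ⊎-map (≅-∷ʳ γ γt≡s) (≅-∷ʳ γ γt≡s) (extension-left-or-right (e23 s) F γe)

  record Closing (a : FourArc) : Set where
    constructor closing
    field
      corner       : Fin n
      tip–corner   : Edge G (tip (ext a)) corner
      corner–start : Edge G corner (x0 (stem a))

  open Closing public

  record Hexagon : Set where
    constructor hexagon
    field
      arc₄    : FourArc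
      closure : Closing arc₄

  open Hexagon public

  head : Hexagon → ThreeArc G
  head = stem ∘ arc₄

  corners : Hexagon → Vec (Fin n) 6
  corners (hexagon a c) = vertices₄ a ∷ʳ corner c

  cycle⇒hexagon : {w : Fin 6 → Fin n} → IsCycle G 5 w → Hexagon
  cycle⇒hexagon {w} C = hexagon
    (arc (w (# 0)) (w (# 1)) (w (# 2)) (w (# 3)) (edges (# 0)) (edges (# 1)) (edges (# 2))
         (different λ ()) (different λ ())
       ⁺ extension (w (# 4)) (edges (# 3)) (different λ ()))
    (closing (w (# 5)) (edges (# 4)) (edges (# 5)))
    where
      open IsCycle C
      different : ∀ {i j} → i ≢ j → w i ≢ w j
      different i≢j wi≡wj = i≢j (distinct wi≡wj)

  closing-transfer : {a b : FourArc} → vertices₄ a ≅ vertices₄ b → Closing a → Closing b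
  closing-transfer (γ , γa≡b) (closing w tw wx) = closing (apply G γ w)
    (subst (λ v → Edge G v (apply G γ w)) (apply-lookup γ γa≡b (# 4)) (Edge-apply γ tw))
    (subst (Edge G (apply G γ w)) (apply-lookup γ γa≡b (# 0)) (Edge-apply γ wx))

  module Hexagons (triangle-free : TriangleFree) (quadrangle-free : QuadrangleFree) where

    rot : Hexagon → Hexagon
    rot (hexagon (s@(arc w₀ w₁ w₂ w₃ e₀₁ e₁₂ e₂₃ n₀₂ n₁₃) ⁺ extension w₄ e₃₄ n₂₄) (closing w₅ e₄₅ e₅₀)) =
      hexagon (arc w₁ w₂ w₃ w₄ e₁₂ e₂₃ e₃₄ n₁₃ n₂₄ ⁺ extension w₅ e₄₅ n₃₅) (closing w₀ e₅₀ e₀₁)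
      where
        n₃₅ : w₃ ≢ w₅
        n₃₅ refl = three-arc-ends-nonadjacent quadrangle-free s e₅₀

    rot⁻¹ : Hexagon → Hexagon
    rot⁻¹ (hexagon (arc w₀ w₁ w₂ w₃ e₀₁ e₁₂ e₂₃ n₀₂ n₁₃ ⁺ extension w₄ e₃₄ n₂₄) (closing w₅ e₄₅ e₅₀)) =
      hexagon (arc w₅ w₀ w₁ w₂ e₅₀ e₀₁ e₁₂ n₅₁ n₀₂ ⁺ extension w₃ e₂₃ n₁₃) (closing w₄ e₃₄ e₄₅)
      where
        n₅₁ : w₅ ≢ w₁
        n₅₁ refl = three-arc-ends-nonadjacent quadrangle-free (arc w₁ w₂ w₃ w₄ e₁₂ e₂₃ e₃₄ n₁₃ n₂₄) e₄₅

    corners-unique : (h : Hexagon) → Uniqueᵛ.Unique (corners h)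
    corners-unique h =
      let h₁ = rot h ; h₂ = rot h₁ ; h₃ = rot h₂ ; h₄ = rot h₃ ; h₅ = rot h₄
          d₀₁ , d₀₂ , d₀₃ = three-arc-head-distinct triangle-free (head h)
          d₁₂ , d₁₃ , d₁₄ = three-arc-head-distinct triangle-free (head h₁)
          d₂₃ , d₂₄ , d₂₅ = three-arc-head-distinct triangle-free (head h₂)
          d₃₄ , d₃₅ , _   = three-arc-head-distinct triangle-free (head h₃)
          d₄₅ , d₄₀ , _   = three-arc-head-distinct triangle-free (head h₄)
          d₅₀ , d₅₁ , _   = three-arc-head-distinct triangle-free (head h₅)
      in  (d₀₁ ∷ d₀₂ ∷ d₀₃ ∷ ≢-sym d₄₀ ∷ ≢-sym d₅₀ ∷ [])
        ∷ (d₁₂ ∷ d₁₃ ∷ d₁₄ ∷ ≢-sym d₅₁ ∷ [])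
        ∷ (d₂₃ ∷ d₂₄ ∷ d₂₅ ∷ [])
        ∷ (d₃₄ ∷ d₃₅ ∷ [])
        ∷ (d₄₅ ∷ [])
        ∷ [] ∷ []

    hexagon-cycle : (h : Hexagon) → IsCycle G 5 (lookup (corners h))
    hexagon-cycle h = record
      { length≥3 = s≤s (s≤s (s≤s z≤n))
      ; distinct = λ {i} {j} → lookup-injective (corners-unique h) i j
      ; edges    = λ where
          zero                                → e01 (head h)
          (suc zero)                          → e12 (head h)
          (suc (suc zero))                    → e23 (head h)
          (suc (suc (suc zero)))              → step (ext (arc₄ h))
          (suc (suc (suc (suc zero))))        → tip–corner (closure h)
          (suc (suc (suc (suc (suc zero))))) → corner–start (closure h)
      }

    hexagon-consistent : (h : Hexagon) → vertices₄ (arc₄ h) ≅ vertices₄ (arc₄ (rot h)) →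
                         Consistent G 5 (lookup (corners h))
    hexagon-consistent h (γ , shift) = γ , λ where
        zero                                → moved (# 0)
        (suc zero)                          → moved (# 1)
        (suc (suc zero))                    → moved (# 2)
        (suc (suc (suc zero)))              → moved (# 3)
        (suc (suc (suc (suc zero))))        → moved (# 4)
        (suc (suc (suc (suc (suc zero))))) → last-moved
      where
        moved : ∀ i → apply G γ (lookup (vertices₄ (arc₄ h)) i) ≡ lookup (vertices₄ (arc₄ (rot h))) i
        moved = apply-lookup γ shift
        γw₅ = apply G γ (corner (closure h))
        last-moved : γw₅ ≡ x0 (head h)
        last-moved = sym (common-neighbour-unique quadrangle-free (n02 (head (rot⁻¹ h)))
          (corner–start (closure h)) (e01 (head h))
          (subst (λ v → Edge G v γw₅) (moved (# 4)) (Edge-apply γ (tip–corner (closure h))))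
          (subst (Edge G γw₅) (moved (# 0)) (Edge-apply γ (corner–start (closure h)))))

  ConsistentHexagon : Set
  ConsistentHexagon = Σ (Fin 6 → Fin n) λ w → IsCycle G 5 w × Consistent G 5 w

  module Cubic3ArcTransitiveGirth6 (cubic : Cubic G) (3at : ThreeArcTransitive G) (girth6 : HasGirth G 6) where

    quadrangle-free : QuadrangleFree
    quadrangle-free = girth>4⇒quadrangle-free girth6 (s≤s (s≤s (s≤s (s≤s (s≤s z≤n)))))

    open Hexagons (girth>3⇒triangle-free girth6 (s≤s (s≤s (s≤s (s≤s z≤n))))) quadrangle-free
    open TwoClassWalks FourArc-setoid
    open Walks ConsistentHexagon

    h : Fin 6 → Fin n
    h = proj₁ (proj₁ girth6)

    base : Hexagon
    base = cycle⇒hexagon (proj₂ (proj₁ girth6))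

    consecutive-apart : (hex : Hexagon) → Apart (arc₄ hex) (arc₄ (rot hex))
    consecutive-apart hex shift = lookup (corners hex) , hexagon-cycle hex , hexagon-consistent hex shift

    consecutive-apart⁻ : (hex : Hexagon) → Apart (arc₄ (rot hex)) (arc₄ hex)
    consecutive-apart⁻ hex = apart-sym {arc₄ hex} {arc₄ (rot hex)} (consecutive-apart hex)

    siblings-apart : (s : ThreeArc G) (F : Fork (x2 s) (x3 s)) → Apart (s ⁺ left F) (s ⁺ right F)
    siblings-apart s F l≅r = consecutive-apart base (collapse {p = s ⁺ left F} {q = s ⁺ right F}
      (λ a → ≅-left-or-right cubic 3at a s F) l≅r (arc₄ base) (arc₄ (rot base)))

    pivot : ThreeArc G
    pivot = head (rot base)

    pivot-fork : Fork (x2 pivot) (x3 pivot)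
    pivot-fork = fork-from cubic (e23 pivot) (ext (arc₄ (rot base)))

    four-arc-closes : (a : FourArc) → ConsistentHexagon ⊎ Closing a
    four-arc-closes a with ≅-left-or-right cubic 3at (arc₄ base) pivot pivot-fork
                         | ≅-left-or-right cubic 3at a pivot pivot-fork
    ... | inj₁ base≅rot   | _            = inj₁ (consecutive-apart base base≅rot)
    ... | inj₂ _          | inj₁ a≅rot   = inj₂ (closing-transfer (≅-sym a≅rot) (closure (rot base)))
    ... | inj₂ base≅other | inj₂ a≅other =
      inj₂ (closing-transfer (≅-sym a≅other)
              (closing-transfer {arc₄ base} {pivot ⁺ right pivot-fork} base≅other (closure base)))

    closing-or-done : (a : FourArc) → (Closing a → ConsistentHexagon) → ConsistentHexagon
    closing-or-done a k = [ id , k ]′ (four-arc-closes a)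

    s₀ : ThreeArc G
    s₀ = head base

    fork₂₃ : Fork (h (# 2)) (h (# 3))
    fork₂₃ = fork-from cubic (e23 s₀) (ext (arc₄ base))

    fork₃₂ : Fork (h (# 3)) (h (# 2))
    fork₃₂ = fork-from cubic (Edge-sym (e23 s₀))
               (extension (h (# 1)) (Edge-sym (e12 s₀)) (≢-sym (n13 s₀)))

    p q : Fin n
    p = tip (right fork₂₃)
    q = tip (right fork₃₂)

    two-classes : TwoClasses (arc₄ base) (s₀ ⁺ right fork₂₃)
    two-classes a = ≅-left-or-right cubic 3at a s₀ fork₂₃

    a₁ a₂ : FourArc
    a₁ = s₀ ⁺ right fork₂₃
    a₂ = arc q (h (# 2)) (h (# 3)) (h (# 4)) (Edge-sym (step (right fork₃₂))) (e23 s₀) (step (left fork₂₃))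
             (≢-sym (no-return (right fork₃₂))) (no-return (left fork₂₃))
         ⁺ ext (arc₄ (rot base))

    module Configuration (c₁ : Closing a₁) (c₂ : Closing a₂) where

      hex₁ hex₂ : Hexagon
      hex₁ = hexagon a₁ c₁
      hex₂ = hexagon a₂ c₂

      a₃ : FourArc
      a₃ = head (rot⁻¹ hex₂) ⁺ right fork₂₃

      h₀≢c₂ : h (# 0) ≢ corner c₂
      h₀≢c₂ h₀≡c₂ = tips-differ fork₃₂ (common-neighbour-unique quadrangle-free (n02 s₀) (e01 s₀) (e12 s₀)
        (subst (λ v → Edge G v q) (sym h₀≡c₂) (corner–start c₂)) (Edge-sym (step (right fork₃₂))))

      module _ (c₃ : Closing a₃) where

        hex₃ : Hexagon
        hex₃ = hexagon a₃ c₃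

        a₄ : FourArc
        a₄ = head (rot hex₁) ⁺ ext (arc₄ (rot hex₃))

        c₃≢c₁ : corner c₃ ≢ corner c₁
        c₃≢c₁ c₃≡c₁ = no-return (ext (arc₄ (rot base))) h₃≡h₅
          where
            h₅≡c₃ : h (# 5) ≡ corner c₃
            h₅≡c₃ = common-neighbour-unique quadrangle-free h₀≢c₂
              (Edge-sym (corner–start (closure base))) (tip–corner c₂)
              (Edge-sym (subst (λ v → Edge G v (h (# 0))) (sym c₃≡c₁) (corner–start c₁))) (corner–start c₃)
            h₃≡h₅ : h (# 3) ≡ h (# 5)
            h₃≡h₅ = common-neighbour-unique quadrangle-free (≢-sym (tips-differ fork₂₃))
              (Edge-sym (step (right fork₂₃))) (step (left fork₂₃))
              (subst (Edge G p) (sym h₅≡c₃) (tip–corner c₃)) (Edge-sym (tip–corner (closure base)))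

        module _ (c₄ : Closing a₄) where

          hex₄ : Hexagon
          hex₄ = hexagon a₄ c₄

          c₂≢c₄ : corner c₂ ≢ corner c₄
          c₂≢c₄ c₂≡c₄ = n02 (head (rot⁻¹ hex₂)) (sym (common-neighbour-unique quadrangle-free
            (tips-differ fork₃₂) (e12 s₀) (step (right fork₃₂))
            (Edge-sym (subst (λ v → Edge G v (h (# 1))) (sym c₂≡c₄) (corner–start c₄))) (corner–start c₂)))

          walk : OddWalk (arc₄ base) (arc₄ base)
          walk =
            arc₄ base             ─⟨ consecutive-apart base ⟩
            arc₄ (rot base)       ─⟨ consecutive-apart (rot base) ⟩
            arc₄ (rot (rot base)) ─⟨ siblings-apart (head (rot (rot base)))
                                       (fork (ext (arc₄ (rot (rot base)))) (ext (arc₄ (rot hex₂))) h₀≢c₂) ⟩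
            arc₄ (rot hex₂)       ─⟨ consecutive-apart⁻ hex₂ ⟩
            arc₄ hex₂             ─⟨ consecutive-apart⁻ (rot⁻¹ hex₂) ⟩
            arc₄ (rot⁻¹ hex₂)     ─⟨ siblings-apart (head (rot⁻¹ hex₂)) fork₂₃ ⟩
            arc₄ hex₃             ─⟨ consecutive-apart hex₃ ⟩
            arc₄ (rot hex₃)       ─⟨ consecutive-apart (rot hex₃) ⟩
            arc₄ (rot (rot hex₃)) ─⟨ siblings-apart (head (rot (rot hex₃)))
                                       (fork (ext (arc₄ (rot (rot hex₃)))) (ext (arc₄ (rot hex₄))) c₂≢c₄) ⟩
            arc₄ (rot hex₄)       ─⟨ consecutive-apart⁻ hex₄ ⟩
            arc₄ hex₄             ─⟨ siblings-apart (head hex₄)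
                                       (fork (ext (arc₄ hex₄)) (ext (arc₄ (rot hex₁))) c₃≢c₁) ⟩
            arc₄ (rot hex₁)       ─⟨ consecutive-apart⁻ hex₁ ⟩
            arc₄ hex₁             ─⟨ apart-sym {s₀ ⁺ left fork₂₃} {s₀ ⁺ right fork₂₃}
                                       (siblings-apart s₀ fork₂₃) ⟩
            arc₄ base             ∎

    consistent-hexagon : ConsistentHexagon
    consistent-hexagon =
      closing-or-done a₁ λ c₁ →
      closing-or-done a₂ λ c₂ →
      let open Configuration c₁ c₂ in
      closing-or-done a₃ λ c₃ →
      closing-or-done (a₄ c₃) λ c₄ →
      odd-walk {p = arc₄ base} {q = s₀ ⁺ right fork₂₃} two-classes (walk c₃ c₄) ≅-refl

mainTheorem8 : ∀ (n : ℕ) (G : SimpleGraph n) → Cubic G → ThreeArcTransitive G → HasGirth G 6 →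
    Σ (Fin 6 → Fin n) λ v → IsCycle G 5 v × Consistent G 5 v
mainTheorem8 n G cubic 3at girth6 = Cubic3ArcTransitiveGirth6.consistent-hexagon cubic 3at girth6
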